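{- Let $m,n\ge 1$, $H\subseteq\{0,\dots,m-1\}$ and $V\subseteq\{1,\dots,n\}$, and suppose $h\in H$ with $h\ge 1$ and $h-1\notin H$. Let $H'=(H\setminus\{h\})\cup\{h-1\}$. Then there is a bijection $\phi:\mathcal P_{m,n}\to\mathcal P_{m,n}$ such that for every path $p$, $\mathrm{CORNERS}^{(H',V)}(\phi(p))=\mathrm{CORNERS}^{(H,V)}(p)$ and $\mathrm{CINDEX}^{(H',V)}(\phi(p))=\mathrm{CINDEX}^{(H,V)}(p)-1$.
   Context: The grid $G_{m,n}$ has nodes $(i,j)$, $0\le i\le m$ (row, downward), $0\le j\le n$ (column, rightward). $\mathcal P_{m,n}$ is the set of lattice paths from $(0,0)$ to $(m,n)$ with unit down and right steps. A true corner is a node where a right step is immediately followed by a down step. For a pair $(H,V)$ with $H\subseteq\{0,\dots,m-1\}$, $V\subseteq\{1,\dots,n\}$, each $h\in H$ marks the node of the path on row $h$ from which it steps down to row $h+1$, and each $v\in V$ marks the node reached by the path's $v$-th right step. $\mathrm{CORNERS}^{(H,V)}(p)$ is the number of nodes that are true corners or marked (each node counted once), and $\mathrm{CINDEX}^{(H,V)}(p)$ is the sum of $i+j$ over these nodes $(i,j)$. -}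

module Defs where

open import Data.Nat using (ℕ; zero; suc; _+_)
open import Data.Bool using (Bool; true; false; _∧_; _∨_; if_then_else_)
open import Data.List using (List; []; _∷_; length; map)
open import Data.Nat.ListAction using (sum)
open import Data.Product using (_×_; _,_)
open import Data.Vec using ([]; _∷_)
open import Data.Fin.Subset using (Subset)

-- Lattice paths from (0,0) to (m,n) with unit steps down (D) and right (R).
-- A value of type Path m n is the sequence of steps still to be taken
-- when m down steps and n right steps remain.
data Path : ℕ → ℕ → Set where
  []   : Path 0 0
  D∷_  : ∀ {m n} → Path m n → Path (suc m) n
  R∷_  : ∀ {m n} → Path m n → Path m (suc n)

-- Membership of a natural number k in a subset of {0,…,m-1} (false if k ≥ m).
memℕ : ∀ {m} → Subset m → ℕ → Bool
memℕ []       _       = false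
memℕ (b ∷ bs) zero    = b
memℕ (b ∷ bs) (suc k) = memℕ bs k

-- V ⊆ {1,…,n} is encoded as a Subset n where index k stands for v = k+1.
memV : ∀ {n} → Subset n → ℕ → Bool
memV V zero    = false
memV V (suc j) = memℕ V j

-- Walk along the remaining path p, currently at node (i , j);
-- prevR = true iff the step into the current node was a right step.
-- Returns the list of nodes that are true corners or marked (each node of
-- the path is visited exactly once, so each is listed at most once).
markedNodes : ∀ {M N m n} → Subset M → Subset N →
              (i j : ℕ) → (prevR : Bool) → Path m n → List (ℕ × ℕ)
markedNodes H V i j prevR [] =
  if (prevR ∧ memV V j) then (i , j) ∷ [] else []
markedNodes H V i j prevR (D∷ p) =
  let corner = prevR               -- right step followed by down step
      hmark  = memℕ H i
      vmark  = prevR ∧ memV V j    -- node reached by the j-th right step, j ∈ V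
      rest   = markedNodes H V (suc i) j false p
  in if (corner ∨ hmark ∨ vmark) then (i , j) ∷ rest else rest
markedNodes H V i j prevR (R∷ p) =
  let vmark  = prevR ∧ memV V j
      rest   = markedNodes H V i (suc j) true p
  in if vmark then (i , j) ∷ rest else rest

CORNERS : ∀ {m n} → Subset m → Subset n → Path m n → ℕ
CORNERS H V p = length (markedNodes H V 0 0 false p)

CINDEX : ∀ {m n} → Subset m → Subset n → Path m n → ℕ
CINDEX H V p = sum (map (λ { (i , j) → i + j }) (markedNodes H V 0 0 false p))

module Submission where

-- Write k = h₋₁, so the mark moves from row k+1 (in H) to row k (in H').
-- The bijection only alters the part of a path crossing rows k and k+1.  There
-- the path enters row k at a column j₀ (by a down step, or at the start), walks
-- right to a column x, steps down, walks right to a column e and steps down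
-- again.  The map keeps j₀ and e and moves x:
--   * if x > j₀ and (x ∉ V or x = e), x moves left to the last column y < x
--     with y = j₀ or y ∉ V;
--   * otherwise x moves right to the first column of V in (x , e), or to e.
-- Comparing the marked nodes of the two rows before (with H) and after (with
-- H') case by case, they correspond one to one and their total weight i + j
-- drops by exactly one; all other rows are untouched.  The same map built from
-- the complement of V undoes it, which makes it a bijection.

open import Defs
open import Data.Nat using (ℕ; zero; suc; _≥_; _+_; _≤_; _<_; s≤s)
open import Data.Nat.Properties
  using (+-suc; +-identityʳ; m≤n+m; n<1+n; <-trans; m<n⇒m<1+n; <⇒≢; >⇒≢)
open import Data.Bool using (Bool; true; false; _∧_; _∨_; not; if_then_else_)
open import Data.Bool.Properties
  using (not-involutive; ∨-zeroʳ; ∧-zeroʳ; ∨-identityʳ; ∧-identityʳ)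
open import Data.List using (List; _∷_; length; map)
open import Data.Nat.ListAction using (sum)
open import Data.Vec using ([]; _∷_; here; there)
open import Data.Fin using (Fin; toℕ; zero; suc)
open import Data.Fin.Properties using (toℕ<n)
open import Data.Fin.Subset using (Subset; _∈_; _∉_; _─_; _∪_; ⁅_⁆; ⊥)
open import Function.Bundles using (Bijection; _⤖_; mk↔ₛ′)
open import Function.Properties.Inverse using (↔⇒⤖)
open import Relation.Binary.PropositionalEquality
  using (_≡_; _≢_; refl; sym; trans; cong; subst)
open import Relation.Nullary using (contradiction)
open import Data.Product using (Σ; _×_; _,_; proj₁; proj₂)

memℕ-∪ : ∀ {n} (A B : Subset n) r → memℕ (A ∪ B) r ≡ memℕ A r ∨ memℕ B r
memℕ-∪ []      []      r       = refl
memℕ-∪ (a ∷ A) (b ∷ B) zero    = refl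
memℕ-∪ (a ∷ A) (b ∷ B) (suc r) = memℕ-∪ A B r

memℕ-─ : ∀ {n} (A B : Subset n) r → memℕ (A ─ B) r ≡ memℕ A r ∧ not (memℕ B r)
memℕ-─ []      []          r       = refl
memℕ-─ (a ∷ A) (true ∷ B)  zero    = sym (∧-zeroʳ a)
memℕ-─ (a ∷ A) (false ∷ B) zero    = sym (∧-identityʳ a)
memℕ-─ (a ∷ A) (b ∷ B)     (suc r) = memℕ-─ A B r

memℕ-⊥ : ∀ {n} r → memℕ (⊥ {n}) r ≡ false
memℕ-⊥ {zero}  r       = refl
memℕ-⊥ {suc n} zero    = refl
memℕ-⊥ {suc n} (suc r) = memℕ-⊥ {n} r

memℕ-⁅⁆-self : ∀ {n} (f : Fin n) → memℕ ⁅ f ⁆ (toℕ f) ≡ true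
memℕ-⁅⁆-self zero    = refl
memℕ-⁅⁆-self (suc f) = memℕ-⁅⁆-self f

memℕ-⁅⁆-other : ∀ {n} (f : Fin n) r → r ≢ toℕ f → memℕ ⁅ f ⁆ r ≡ false
memℕ-⁅⁆-other zero    zero    r≢f = contradiction refl r≢f
memℕ-⁅⁆-other {suc n} zero (suc r) r≢f = memℕ-⊥ {n} r
memℕ-⁅⁆-other (suc f) zero    r≢f = refl
memℕ-⁅⁆-other (suc f) (suc r) r≢f = memℕ-⁅⁆-other f r (λ e → r≢f (cong suc e))

memℕ-∈ : ∀ {n} {f : Fin n} {A : Subset n} → f ∈ A → memℕ A (toℕ f) ≡ true
memℕ-∈ here      = refl
memℕ-∈ (there f∈A) = memℕ-∈ f∈A

memℕ⇒∈ : ∀ {n} (f : Fin n) (A : Subset n) → memℕ A (toℕ f) ≡ true → f ∈ A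
memℕ⇒∈ zero    (true ∷ A) _ = here
memℕ⇒∈ (suc f) (a ∷ A)    e = there (memℕ⇒∈ f A e)

memℕ-∉ : ∀ {n} {f : Fin n} {A : Subset n} → f ∉ A → memℕ A (toℕ f) ≡ false
memℕ-∉ {f = f} {A} f∉A with memℕ A (toℕ f) in e
... | false = refl
... | true  = contradiction (memℕ⇒∈ f A e) f∉A

record MarkMovedUp {M} (H H' : Subset M) (k : ℕ) : Set where
  field
    H-k       : memℕ H k ≡ false
    H-k+1     : memℕ H (suc k) ≡ true
    H'-k      : memℕ H' k ≡ true
    H'-k+1    : memℕ H' (suc k) ≡ false
    elsewhere : ∀ r → r ≢ k → r ≢ suc k → memℕ H' r ≡ memℕ H r

moveMarkUp : ∀ {m} (H : Subset m) (h h₋₁ : Fin m) →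
             h ∈ H → toℕ h ≡ suc (toℕ h₋₁) → h₋₁ ∉ H →
             MarkMovedUp H ((H ─ ⁅ h ⁆) ∪ ⁅ h₋₁ ⁆) (toℕ h₋₁)
moveMarkUp {m} H h h₋₁ h∈H h≡1+h₋₁ h₋₁∉H = record
  { H-k       = memℕ-∉ h₋₁∉H
  ; H-k+1     = subst (λ r → memℕ H r ≡ true) h≡1+h₋₁ (memℕ-∈ h∈H)
  ; H'-k      = H'-k
  ; H'-k+1    = H'-k+1
  ; elsewhere = elsewhere
  }
  where
  k : ℕ
  k = toℕ h₋₁
  H' : Subset m
  H' = (H ─ ⁅ h ⁆) ∪ ⁅ h₋₁ ⁆

  H'-k : memℕ H' k ≡ true
  H'-k rewrite memℕ-∪ (H ─ ⁅ h ⁆) ⁅ h₋₁ ⁆ k | memℕ-⁅⁆-self h₋₁ = ∨-zeroʳ _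

  H'-k+1 : memℕ H' (suc k) ≡ false
  H'-k+1 rewrite memℕ-∪ (H ─ ⁅ h ⁆) ⁅ h₋₁ ⁆ (suc k) | memℕ-─ H ⁅ h ⁆ (suc k)
               | subst (λ r → memℕ ⁅ h ⁆ r ≡ true) h≡1+h₋₁ (memℕ-⁅⁆-self h)
               | memℕ-⁅⁆-other h₋₁ (suc k) (>⇒≢ (n<1+n k))
               | ∧-zeroʳ (memℕ H (suc k)) = refl

  elsewhere : ∀ r → r ≢ k → r ≢ suc k → memℕ H' r ≡ memℕ H r
  elsewhere r r≢k r≢1+k
    rewrite memℕ-∪ (H ─ ⁅ h ⁆) ⁅ h₋₁ ⁆ r | memℕ-─ H ⁅ h ⁆ r
          | memℕ-⁅⁆-other h r (λ e → r≢1+k (trans e h≡1+h₋₁))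
          | memℕ-⁅⁆-other h₋₁ r r≢k
          | ∧-identityʳ (memℕ H r) = ∨-identityʳ _

-- (2) The row swap.

startsRight : ∀ {a N} → Path a N → Bool
startsRight (R∷ _) = true
startsRight _      = false

dropDown : ∀ {a N} → Path (suc a) N → Path a N
dropDown (D∷ p) = p
dropDown (R∷ p) = R∷ dropDown p

-- The functions below walk along the upper of the two rows being swapped; the
-- ℕ argument is the current column and P the set of columns at which the down
-- step of that row may be placed when it moves right.
module Swap (P : ℕ → Bool) where

  -- From column j, the path steps right only from columns in P, and its first
  -- down step is taken from a column outside P or is followed by another down
  -- step.  When this holds at j+1, the down step can be slid back to column j.
  backable : ∀ {a N} → ℕ → Path a N → Bool
  backable j []     = false
  backable j (D∷ p) = not (P j) ∨ not (startsRight p)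
  backable j (R∷ p) = P j ∧ backable (suc j) p

  sinkDown : ∀ {a N} → ℕ → Path (suc a) N → Path (suc (suc a)) N
  sinkDown j (D∷ q) = D∷ D∷ q
  sinkDown j (R∷ p) = if P j then D∷ R∷ p else R∷ sinkDown (suc j) p

  -- The swap of the current row with the next one, entered at column j;
  -- entered tells whether the current node was reached by a right step.
  swapRows : ∀ {a N} → Bool → ℕ → Path (suc (suc a)) N → Path (suc (suc a)) N
  swapRows entered j (D∷ D∷ q) = D∷ D∷ q
  swapRows entered j (D∷ R∷ p) =
    if not entered ∨ P j then R∷ sinkDown (suc j) p else D∷ R∷ p
  swapRows entered j (R∷ p) =
    if (not entered ∨ not (P j)) ∧ backable (suc j) p
    then D∷ R∷ dropDown p else R∷ swapRows true (suc j) p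

  swapHere : ∀ {a N} → ℕ → Path a N → Path a N
  swapHere {zero}        j p = p
  swapHere {suc zero}    j p = p
  swapHere {suc (suc a)} j p = swapRows false j p

  -- Swap the rows d and d+1 down steps ahead of the current node.
  swapRowsAt : ∀ {a N} → ℕ → ℕ → Path a N → Path a N
  swapRowsAt zero    j p      = swapHere j p
  swapRowsAt (suc d) j []     = []
  swapRowsAt (suc d) j (R∷ p) = R∷ swapRowsAt (suc d) (suc j) p
  swapRowsAt (suc d) j (D∷ p) = D∷ swapRowsAt d j p

-- (3) The swaps for complementary predicates are mutually inverse.
module Complementary (P Q : ℕ → Bool) (Q≡¬P : ∀ t → Q t ≡ not (P t)) where
  module SP = Swap P
  module SQ = Swap Q

  backable-sinkDown : ∀ {a N} j (p : Path (suc a) N) →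
                      SQ.backable j (SP.sinkDown j p) ≡ true
  backable-sinkDown j (D∷ q) = ∨-zeroʳ _
  backable-sinkDown j (R∷ p) with P j in Pj
  ... | true  rewrite Q≡¬P j | Pj = refl
  ... | false rewrite Q≡¬P j | Pj = backable-sinkDown (suc j) p

  dropDown-sinkDown : ∀ {a N} j (p : Path (suc a) N) → dropDown (SP.sinkDown j p) ≡ p
  dropDown-sinkDown j (D∷ q) = refl
  dropDown-sinkDown j (R∷ p) with P j
  ... | true  = refl
  ... | false = cong R∷_ (dropDown-sinkDown (suc j) p)

  sinkDown-dropDown : ∀ {a N} j (p : Path (suc (suc a)) N) →
                      SP.backable j p ≡ true → SQ.sinkDown j (dropDown p) ≡ p
  sinkDown-dropDown j (D∷ D∷ q) _ = refl
  sinkDown-dropDown j (D∷ R∷ p) b rewrite Q≡¬P j with P j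
  ... | false = refl
  sinkDown-dropDown j (D∷ R∷ p) () | true
  sinkDown-dropDown j (R∷ p) b rewrite Q≡¬P j with P j
  ... | true = cong R∷_ (sinkDown-dropDown (suc j) p b)
  sinkDown-dropDown j (R∷ p) () | false

  -- Undoing a swap, together with the invariant that a swap entered by a right
  -- step is never at a backable position (for either predicate).
  swapRows-inverse : ∀ {a N} entered j (p : Path (suc (suc a)) N) →
    entered ∧ SP.backable j p ≡ false →
    (SQ.swapRows entered j (SP.swapRows entered j p) ≡ p) ×
    (entered ∧ SQ.backable j (SP.swapRows entered j p) ≡ false)
  swapRows-inverse false j (D∷ D∷ q) _ = refl , refl
  swapRows-inverse true  j (D∷ D∷ q) b rewrite ∨-zeroʳ (not (P j)) with b
  ... | ()
  swapRows-inverse false j (D∷ R∷ p) _ rewrite backable-sinkDown (suc j) p =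
    cong (λ x → D∷ R∷ x) (dropDown-sinkDown (suc j) p) , refl
  swapRows-inverse true j (D∷ R∷ p) b with P j in Pj
  ... | true rewrite Q≡¬P j | Pj | backable-sinkDown (suc j) p =
    cong (λ x → D∷ R∷ x) (dropDown-sinkDown (suc j) p) , refl
  ... | false with b
  ... | ()
  swapRows-inverse entered j (R∷ p) b with SP.backable (suc j) p in bP
  ... | false rewrite ∧-zeroʳ (not entered ∨ not (P j)) = undo , stays
    where
    ih : (SQ.swapRows true (suc j) (SP.swapRows true (suc j) p) ≡ p) ×
         (SQ.backable (suc j) (SP.swapRows true (suc j) p) ≡ false)
    ih = swapRows-inverse true (suc j) p bP

    undo : SQ.swapRows entered j (R∷ SP.swapRows true (suc j) p) ≡ R∷ p
    undo rewrite proj₂ ih | ∧-zeroʳ (not entered ∨ not (Q j)) = cong R∷_ (proj₁ ih)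

    stays : entered ∧ (Q j ∧ SQ.backable (suc j) (SP.swapRows true (suc j) p)) ≡ false
    stays rewrite proj₂ ih | ∧-zeroʳ (Q j) | ∧-zeroʳ entered = refl
  ... | true with entered | P j in Pj
  ... | false | _     = cong R∷_ (sinkDown-dropDown (suc j) p bP) , refl
  ... | true  | true  = contradiction b λ ()
  ... | true  | false rewrite Q≡¬P j | Pj =
    cong R∷_ (sinkDown-dropDown (suc j) p bP) , refl

  swapRowsAt-inverse : ∀ {a N} d j (p : Path a N) →
                       SQ.swapRowsAt d j (SP.swapRowsAt d j p) ≡ p
  swapRowsAt-inverse {zero}        zero j p = refl
  swapRowsAt-inverse {suc zero}    zero j p = refl
  swapRowsAt-inverse {suc (suc a)} zero j p = proj₁ (swapRows-inverse false j p refl)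
  swapRowsAt-inverse (suc d) j []     = refl
  swapRowsAt-inverse (suc d) j (R∷ p) = cong R∷_ (swapRowsAt-inverse (suc d) (suc j) p)
  swapRowsAt-inverse (suc d) j (D∷ p) = cong D∷_ (swapRowsAt-inverse d j p)

swapBijection : ∀ {m n} (P : ℕ → Bool) (d : ℕ) → Path m n ⤖ Path m n
swapBijection P d = ↔⇒⤖ (mk↔ₛ′ (Swap.swapRowsAt P d 0) (Swap.swapRowsAt ¬P d 0)
  (Complementary.swapRowsAt-inverse ¬P P (λ t → sym (not-involutive (P t))) d 0)
  (Complementary.swapRowsAt-inverse P ¬P (λ t → refl) d 0))
  where
  ¬P : ℕ → Bool
  ¬P t = not (P t)

-- (4) Effect on the marked nodes.

weight : List (ℕ × ℕ) → ℕ
weight L = sum (map (λ { (i , j) → i + j }) L)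

OneLighter : List (ℕ × ℕ) → List (ℕ × ℕ) → Set
OneLighter A B = (length A ≡ length B) × (suc (weight A) ≡ weight B)

OneLighter-consIf : ∀ b (x : ℕ × ℕ) {A B} → OneLighter A B →
                    OneLighter (if b then x ∷ A else A) (if b then x ∷ B else B)
OneLighter-consIf false x r = r
OneLighter-consIf true (i , j) {A} (len , wt) =
  cong suc len , trans (sym (+-suc (i + j) (weight A))) (cong (i + j +_) wt)

OneLighter-extra : ∀ k j {A B} →
                   (suc (length A) ≡ length B) × (k + suc j + weight A ≡ weight B) →
                   OneLighter ((k , j) ∷ A) B
OneLighter-extra k j {A} (len , wt) =
  len , trans (cong (_+ weight A) (sym (+-suc k j))) wt

above : ∀ {i k} d → suc d + i ≡ k → i < k
above {i} d e = subst (i <_) e (s≤s (m≤n+m i d))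

module MovedMark {M N'} (H H' : Subset M) (V : Subset N') (k : ℕ)
                 (moved : MarkMovedUp H H' k) where
  open MarkMovedUp moved
  open Swap (memV V)

  marks marks' : ∀ {a N} → ℕ → ℕ → Bool → Path a N → List (ℕ × ℕ)
  marks  = markedNodes H V
  marks' = markedNodes H' V

  marks-below : ∀ {a N} i j entered (p : Path a N) → suc k < i →
                marks' i j entered p ≡ marks i j entered p
  marks-below i j entered []     _ = refl
  marks-below i j entered (R∷ p) lt =
    cong (λ X → if entered ∧ memV V j then (i , j) ∷ X else X)
         (marks-below i (suc j) true p lt)
  marks-below i j entered (D∷ p) lt
    rewrite elsewhere i (>⇒≢ (<-trans (n<1+n k) lt)) (>⇒≢ lt) =
    cong (λ X → if entered ∨ memℕ H i ∨ entered ∧ memV V j then (i , j) ∷ X else X)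
         (marks-below (suc i) j false p (m<n⇒m<1+n lt))

  marks-row-k+1 : ∀ {a N} j (p : Path (suc a) N) →
                  marks' (suc k) j true p ≡ marks (suc k) j true p
  marks-row-k+1 j (R∷ p) =
    cong (λ X → if memV V j then (suc k , j) ∷ X else X) (marks-row-k+1 (suc j) p)
  marks-row-k+1 j (D∷ q) = cong ((suc k , j) ∷_) (marks-below (suc (suc k)) j false q (n<1+n _))

  -- Sinking the down step into row k+1: the mark of row k+1 becomes the new
  -- corner on row k.
  sinkDown-marks : ∀ {a N} j (p : Path (suc a) N) →
                   OneLighter (marks' k j true (sinkDown j p)) (marks (suc k) j true p)
  sinkDown-marks j (D∷ q)
    rewrite H'-k+1 | marks-below (suc (suc k)) j false q (n<1+n _) = refl , refl
  sinkDown-marks j (R∷ p) with memV V j in Vj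
  ... | true  rewrite marks-row-k+1 (suc j) p = refl , refl
  ... | false rewrite Vj = sinkDown-marks (suc j) p

  -- Deleting the down step of row k at a backable position loses exactly the
  -- node where it was taken, turning the later row-k nodes into row-k+1 nodes.
  dropDown-marks : ∀ {a N} j (p : Path (suc (suc a)) N) → backable j p ≡ true →
    (suc (length (marks' (suc k) j true (dropDown p))) ≡ length (marks k j true p)) ×
    (k + j + weight (marks' (suc k) j true (dropDown p)) ≡ weight (marks k j true p))
  dropDown-marks j (D∷ D∷ q) _
    rewrite H-k+1 | marks-below (suc (suc k)) j false q (n<1+n _) = refl , refl
  dropDown-marks j (D∷ R∷ p) b with memV V j
  ... | false rewrite marks-row-k+1 (suc j) p = refl , refl
  dropDown-marks j (D∷ R∷ p) () | true
  dropDown-marks j (R∷ p) b with memV V j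
  ... | true =
    cong suc (proj₁ ih) ,
    cong (k + j +_) (trans (cong (_+ weight rest) (sym (+-suc k j))) (proj₂ ih))
    where
    rest : List (ℕ × ℕ)
    rest = marks' (suc k) (suc j) true (dropDown p)
    ih : (suc (length rest) ≡ length (marks k (suc j) true p)) ×
         (k + suc j + weight rest ≡ weight (marks k (suc j) true p))
    ih = dropDown-marks (suc j) p b
  dropDown-marks j (R∷ p) () | false

  -- Sliding the down step of row k back to column j, the node (k , j) becomes
  -- a corner, marked with H'.
  slideBack-marks : ∀ {a N} j (p : Path (suc (suc a)) N) → backable (suc j) p ≡ true →
    OneLighter ((k , j) ∷ marks' (suc k) (suc j) true (dropDown p)) (marks k (suc j) true p)
  slideBack-marks j p b =
    OneLighter-extra k j {marks' (suc k) (suc j) true (dropDown p)} {marks k (suc j) true p}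
                     (dropDown-marks (suc j) p b)

  swapRows-marks : ∀ {a N} entered j (p : Path (suc (suc a)) N) →
                   entered ∧ backable j p ≡ false →
                   OneLighter (marks' k j entered (swapRows entered j p)) (marks k j entered p)
  swapRows-marks false j (D∷ D∷ q) _
    rewrite H'-k | H-k | H-k+1 | H'-k+1 | marks-below (suc (suc k)) j false q (n<1+n _) =
    refl , refl
  swapRows-marks true j (D∷ D∷ q) b rewrite ∨-zeroʳ (not (memV V j)) with b
  ... | ()
  swapRows-marks false j (D∷ R∷ p) _ rewrite H-k = sinkDown-marks (suc j) p
  swapRows-marks true j (D∷ R∷ p) b with memV V j in Vj
  ... | true rewrite Vj = OneLighter-consIf true (k , j)
    {marks' k (suc j) true (sinkDown (suc j) p)} {marks (suc k) (suc j) true p}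
    (sinkDown-marks (suc j) p)
  swapRows-marks true j (D∷ R∷ p) () | false
  swapRows-marks entered j (R∷ p) b with backable (suc j) p in bp
  ... | false rewrite ∧-zeroʳ (not entered ∨ not (memV V j)) =
    OneLighter-consIf (entered ∧ memV V j) (k , j) (swapRows-marks true (suc j) p bp)
  ... | true with entered | memV V j
  ... | true  | true  = contradiction b λ ()
  ... | true  | false = slideBack-marks j p bp
  ... | false | _     rewrite H'-k = slideBack-marks j p bp

  -- Rows above k are untouched; d counts the down steps still to reach row k,
  -- and the path has to cross rows k and k+1.
  swapRowsAt-marks : ∀ {a N} d i j entered (p : Path a N) → d + i ≡ k →
                     suc (suc d) ≤ a → (d ≡ 0 → entered ≡ false) →
                     OneLighter (marks' i j entered (swapRowsAt d j p)) (marks i j entered p)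
  swapRowsAt-marks {zero}        zero i j entered p e ()
  swapRowsAt-marks {suc zero}    zero i j entered p e (s≤s ())
  swapRowsAt-marks {suc (suc a)} zero i j entered p refl _ atRow with atRow refl
  ... | refl = swapRows-marks false j p refl
  swapRowsAt-marks (suc d) i j entered [] e ()
  swapRowsAt-marks (suc d) i j entered (R∷ p) e twoRows _ =
    OneLighter-consIf (entered ∧ memV V j) (i , j)
      (swapRowsAt-marks (suc d) i (suc j) true p e twoRows (λ ()))
  swapRowsAt-marks (suc d) i j entered (D∷ p) e (s≤s twoRows) _
    rewrite elsewhere i (<⇒≢ (above d e)) (<⇒≢ (m<n⇒m<1+n (above d e))) =
    OneLighter-consIf (entered ∨ memℕ H i ∨ entered ∧ memV V j) (i , j)
      (swapRowsAt-marks d (suc i) j false p (trans (+-suc d i) e) twoRows (λ _ → refl))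

mainTheorem6 : (m n : ℕ) → m ≥ 1 → n ≥ 1 →
    (H : Subset m) (V : Subset n) (h h₋₁ : Fin m) →
    h ∈ H → toℕ h ≡ suc (toℕ h₋₁) → h₋₁ ∉ H →
    Σ (Path m n ⤖ Path m n) λ φ →
      (p : Path m n) →
        (CORNERS ((H ─ ⁅ h ⁆) ∪ ⁅ h₋₁ ⁆) V (Bijection.to φ p) ≡ CORNERS H V p)
        × (suc (CINDEX ((H ─ ⁅ h ⁆) ∪ ⁅ h₋₁ ⁆) V (Bijection.to φ p)) ≡ CINDEX H V p)
mainTheorem6 m n _ _ H V h h₋₁ h∈H h≡1+h₋₁ h₋₁∉H =
  swapBijection (memV V) k , λ p →
    MovedMark.swapRowsAt-marks H H' V k moved k 0 0 false p (+-identityʳ k) twoRows λ _ → refl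
  where
  k : ℕ
  k = toℕ h₋₁
  H' : Subset m
  H' = (H ─ ⁅ h ⁆) ∪ ⁅ h₋₁ ⁆
  moved : MarkMovedUp H H' k
  moved = moveMarkUp H h h₋₁ h∈H h≡1+h₋₁ h₋₁∉H
  twoRows : suc (suc k) ≤ m
  twoRows = subst (λ r → suc r ≤ m) h≡1+h₋₁ (toℕ<n h)
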